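{- For every $n\in\mathbb{N}$, the Sierpiński graph $S(n,3)$ is an AR-graph.
   Context: All graphs are finite, simple and undirected; $\mathbb{N}=\{1,2,3,\dots\}$. The Sierpiński graph $S(n,3)$ has vertex set $\{1,2,3\}^n$, and two distinct vertices $u=(u_1,\dots,u_n)$, $v=(v_1,\dots,v_n)$ are adjacent if and only if there is $h\in\{1,\dots,n\}$ such that $u_t=v_t$ for $t=1,\dots,h-1$, $u_h\ne v_h$, and $u_t=v_h$ and $v_t=u_h$ for $t=h+1,\dots,n$. Let $f:E(G)\to\mathbb{N}$ be an injective edge labeling of a graph $G$. A vertex $v$ is an AR-vertex (under $f$) if, whenever $x_1,\dots,x_k$ are the labels of the $k$ edges incident on $v$, the $2^k$ sums $\sum_{i\in S}x_i$ over all subsets $S\subseteq\{1,\dots,k\}$ are pairwise distinct. An injective labeling $f$ is an AR-labeling if every vertex is an AR-vertex under $f$. A graph $G$ with $m$ edges is an AR-graph if it has an AR-labeling $f:E(G)\to\{1,2,\dots,m\}$. -}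

module Defs where

open import Data.Nat using (ℕ; _<_; _≤_)
open import Data.Fin using (Fin; toℕ)
open import Data.Vec using (Vec; lookup)
open import Data.List using (List; map)
open import Data.Nat.ListAction using (sum)
open import Data.List.Membership.Propositional using (_∈_)
open import Data.List.Relation.Unary.All using (All)
open import Data.List.Relation.Unary.Unique.Propositional using (Unique)
open import Data.Product using (Σ; ∃; _×_)
open import Data.Sum using (_⊎_)
open import Relation.Binary.PropositionalEquality using (_≡_; _≢_)

-- Vertices of the Sierpiński graph S(n,3): words of length n over {1,2,3}
-- (encoded as Fin 3 = {0,1,2}).
SVertex : ℕ → Set
SVertex n = Vec (Fin 3) n

SAdj : (n : ℕ) → SVertex n → SVertex n → Set
SAdj n u v =
  Σ (Fin n) λ h →
    (∀ (t : Fin n) → toℕ t < toℕ h → lookup u t ≡ lookup v t)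
    × (lookup u h ≢ lookup v h)
    × (∀ (t : Fin n) → toℕ h < toℕ t →
         (lookup u t ≡ lookup v h) × (lookup v t ≡ lookup u h))

-- An edge labeling of S(n,3) is given by a symmetric function on pairs of
-- vertices; the label of the edge {u,v} is f u v (= f v u).  Values on
-- non-adjacent pairs are irrelevant.
Symmetric : (n : ℕ) → (SVertex n → SVertex n → ℕ) → Set
Symmetric n f = ∀ u v → f u v ≡ f v u

InjectiveOnEdges : (n : ℕ) → (SVertex n → SVertex n → ℕ) → Set
InjectiveOnEdges n f =
  ∀ u v u′ v′ → SAdj n u v → SAdj n u′ v′ → f u v ≡ f u′ v′ →
    ((u ≡ u′) × (v ≡ v′)) ⊎ ((u ≡ v′) × (v ≡ u′))

LabelsIn : (n : ℕ) → (SVertex n → SVertex n → ℕ) → ℕ → Set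
LabelsIn n f m = ∀ u v → SAdj n u v → (1 ≤ f u v) × (f u v ≤ m)

-- every label in {1,…,m} is used (with injectivity: m = |E(S(n,3))|).
LabelsOnto : (n : ℕ) → (SVertex n → SVertex n → ℕ) → ℕ → Set
LabelsOnto n f m =
  ∀ k → 1 ≤ k → k ≤ m → ∃ λ u → ∃ λ v → SAdj n u v × (f u v ≡ k)

-- Edges incident on v correspond to
-- neighbours w of v; a subset of them is a duplicate-free list of
-- neighbours, and two subsets with equal label sums must be equal sets.
IsARVertex : (n : ℕ) → (SVertex n → SVertex n → ℕ) → SVertex n → Set
IsARVertex n f v =
  ∀ (S T : List (SVertex n)) →
    Unique S → Unique T → All (SAdj n v) S → All (SAdj n v) T →
    sum (map (f v) S) ≡ sum (map (f v) T) →
    (∀ w → w ∈ S → w ∈ T) × (∀ w → w ∈ T → w ∈ S)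

SierpinskiIsARGraph : ℕ → Set
SierpinskiIsARGraph n =
  ∃ λ (m : ℕ) → ∃ λ (f : SVertex n → SVertex n → ℕ) →
    Symmetric n f × InjectiveOnEdges n f × LabelsIn n f m × LabelsOnto n f m
    × (∀ v → IsARVertex n f v)

-- S(n+1,3) consists of three copies i ∷ S(n,3) joined by the three bridges
-- {i j…j , j i…i}.  With m = |E(S(n,3))|, the copies receive the labels of S(n,3)
-- shifted by 0, m + 3 and 2m + 3, and the bridges the labels m + 1, m + 2, m + 3;
-- these four blocks tile {1, …, 3m + 3}.  Every vertex has degree at most 3, so
-- being an AR-vertex means that its labels are positive, distinct, and none is the
-- sum of the other two.  A shift by at least m preserves this, and a bridge label
-- is smaller than everything in copies 1 and 2, so the only delicate vertices are
-- the extreme vertices 0 j…j of copy 0, where the new bridge label must avoid the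
-- sum of the two inherited labels; an invariant on the label sums of the extreme
-- vertices (ExtremeSum) carries this through the induction.
module Submission where

open import Defs
open import Data.Bool using (Bool; true; false; if_then_else_)
open import Data.Empty using (⊥; ⊥-elim)
open import Data.Fin using (Fin; suc; toℕ)
open import Data.Fin.Patterns using (0F; 1F; 2F)
open import Data.Fin.Properties using (any?) renaming (_≟_ to _≟ᶠ_; <-cmp to <-cmpᶠ)
open import Data.List using (List; []; _∷_; map; _++_)
open import Data.List.Membership.Propositional using (_∈_)
open import Data.List.Membership.Propositional.Properties
  using (∈-map⁺; ∈-map⁻; ∈-++⁺ˡ; ∈-++⁺ʳ; ∈-++⁻)
open import Data.List.Properties using (map-cong; map-++; map-∘; map-id; ++-identityʳ)
open import Data.List.Relation.Unary.All using (All; []; _∷_)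
import Data.List.Relation.Unary.All as All
open import Data.List.Relation.Unary.All.Properties using (map⁺)
open import Data.List.Relation.Unary.AllPairs using ([]; _∷_)
open import Data.List.Relation.Unary.Any using (here; there)
open import Data.List.Relation.Unary.Unique.Propositional using (Unique)
import Data.List.Relation.Unary.Unique.Propositional.Properties as Unique
open import Data.Nat using (ℕ; zero; suc; _+_; _∸_; _≤_; _<_; s≤s; z≤n; z<s)
open import Data.Nat.ListAction using (sum)
open import Data.Nat.Properties
open import Algebra.Properties.CommutativeSemigroup +-commutativeSemigroup
  using (x∙yz≈y∙xz; interchange)
open import Data.Nat.Tactic.RingSolver using (solve-∀)
open import Data.Product using (_×_; _,_; proj₁; proj₂; ∃; ∃₂)
open import Data.Sum using (_⊎_; inj₁; inj₂)
open import Data.Unit using (⊤; tt)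
open import Data.Vec using ([]; _∷_; lookup; replicate)
open import Data.Vec.Properties using (lookup-replicate; ∷-injectiveˡ; ∷-injectiveʳ)
  renaming (≡-dec to ≡-decᵛ)
open import Function using (_∘_)
open import Relation.Binary.Definitions using (DecidableEquality; tri<; tri≈; tri>)
open import Relation.Binary.PropositionalEquality
  using (_≡_; _≢_; refl; sym; trans; cong; cong₂; subst; subst₂; module ≡-Reasoning)
open import Relation.Nullary using (¬_; Dec; yes; no; does)
open import Relation.Nullary.Decidable using (dec-true; dec-false)
open import Relation.Nullary.Negation using (contradiction)

pick : Bool → ℕ → ℕ
pick b x = if b then x else 0

-- A sufficient condition for the subset sums of at most three numbers to be
-- pairwise distinct (pick₃-injective); longer lists never occur in S(n,3).
Dissociated : List ℕ → Set
Dissociated [] = ⊤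
Dissociated (a ∷ []) = 1 ≤ a
Dissociated (a ∷ b ∷ []) = 1 ≤ a × 1 ≤ b × a ≢ b
Dissociated (a ∷ b ∷ c ∷ []) =
  1 ≤ a × 1 ≤ b × 1 ≤ c × a ≢ b × a ≢ c × b ≢ c × a ≢ b + c × b ≢ a + c × c ≢ a + b
Dissociated (_ ∷ _ ∷ _ ∷ _ ∷ _) = ⊥

pick-injective : ∀ {z} → 1 ≤ z → ∀ r r′ → pick r z ≡ pick r′ z → r ≡ r′
pick-injective _ true true _ = refl
pick-injective _ false false _ = refl
pick-injective (s≤s _) true false ()
pick-injective (s≤s _) false true ()

+-pick≢pick : ∀ {y z} → 1 ≤ y → y ≢ z → ∀ r r′ → y + pick r z ≢ pick r′ z
+-pick≢pick {y} {z} 1≤y _ true true = >⇒≢ (m<n+m z 1≤y)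
+-pick≢pick {suc _} _ _ true false ()
+-pick≢pick {y} _ y≢z false true = y≢z ∘ trans (sym (+-identityʳ y))
+-pick≢pick {suc _} _ _ false false ()

pick₂-injective : ∀ {y z} → Dissociated (y ∷ z ∷ []) → ∀ q r q′ r′ →
  pick q y + pick r z ≡ pick q′ y + pick r′ z → q ≡ q′ × r ≡ r′
pick₂-injective {y} (_ , 1≤z , _) true r true r′ e =
  refl , pick-injective 1≤z r r′ (+-cancelˡ-≡ y _ _ e)
pick₂-injective (_ , 1≤z , _) false r false r′ e = refl , pick-injective 1≤z r r′ e
pick₂-injective (1≤y , _ , y≢z) true r false r′ e = ⊥-elim (+-pick≢pick 1≤y y≢z r r′ e)
pick₂-injective (1≤y , _ , y≢z) false r true r′ e = ⊥-elim (+-pick≢pick 1≤y y≢z r′ r (sym e))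

-- After cancelling a common y or z the equation contradicts one of the conditions.
+-pick₂≢pick₂ : ∀ {x y z} → Dissociated (x ∷ y ∷ z ∷ []) → ∀ q r q′ r′ →
  x + (pick q y + pick r z) ≢ pick q′ y + pick r′ z
+-pick₂≢pick₂ {x} {y} {z} (1≤x , _ , _ , _ , x≢z , _ , _ , _ , _) true r true r′ e =
  +-pick≢pick 1≤x x≢z r r′ (+-cancelˡ-≡ y _ _ (trans (sym (x∙yz≈y∙xz x y (pick r z))) e))
+-pick₂≢pick₂ (1≤x , _ , _ , _ , x≢z , _ , _ , _ , _) false r false r′ e =
  +-pick≢pick 1≤x x≢z r r′ e
+-pick₂≢pick₂ {x} {y} {z} (1≤x , _ , _ , _ , _ , _ , _ , _ , _) true true false true e =
  >⇒≢ (m<n+m z (≤-trans 1≤x (m≤m+n x y))) (trans (+-assoc x y z) e)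
+-pick₂≢pick₂ {suc _} _ true true false false ()
+-pick₂≢pick₂ {x} {y} (_ , _ , _ , _ , _ , _ , _ , _ , z≢x+y) true false false true e =
  z≢x+y (sym (trans (cong (x +_) (sym (+-identityʳ y))) e))
+-pick₂≢pick₂ {suc _} _ true false false false ()
+-pick₂≢pick₂ {x} {y} {z} (_ , _ , _ , x≢y , _ , _ , _ , _ , _) false true true true e =
  x≢y (+-cancelʳ-≡ z x y e)
+-pick₂≢pick₂ {x} {y} (_ , _ , _ , _ , _ , _ , _ , y≢x+z , _) false true true false e =
  y≢x+z (sym (trans e (+-identityʳ y)))
+-pick₂≢pick₂ {x} (_ , _ , _ , _ , _ , _ , x≢y+z , _ , _) false false true true e =
  x≢y+z (trans (sym (+-identityʳ x)) e)
+-pick₂≢pick₂ {x} {y} (_ , _ , _ , x≢y , _ , _ , _ , _ , _) false false true false e =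
  x≢y (trans (sym (+-identityʳ x)) (trans e (+-identityʳ y)))

pick₃-injective : ∀ {x y z} → Dissociated (x ∷ y ∷ z ∷ []) → ∀ p q r p′ q′ r′ →
  pick p x + (pick q y + pick r z) ≡ pick p′ x + (pick q′ y + pick r′ z) →
  p ≡ p′ × q ≡ q′ × r ≡ r′
pick₃-injective {x} (_ , 1≤y , 1≤z , _ , _ , y≢z , _) true q r true q′ r′ e =
  refl , pick₂-injective (1≤y , 1≤z , y≢z) q r q′ r′ (+-cancelˡ-≡ x _ _ e)
pick₃-injective (_ , 1≤y , 1≤z , _ , _ , y≢z , _) false q r false q′ r′ e =
  refl , pick₂-injective (1≤y , 1≤z , y≢z) q r q′ r′ e
pick₃-injective d true q r false q′ r′ e = ⊥-elim (+-pick₂≢pick₂ d q r q′ r′ e)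
pick₃-injective d false q r true q′ r′ e = ⊥-elim (+-pick₂≢pick₂ d q′ r′ q r (sym e))

shift-sum-free : ∀ {s a b c} → a ≤ s → 1 ≤ b → s + a ≢ (s + b) + (s + c)
shift-sum-free {s} {a} {b} {c} a≤s 1≤b = <⇒≢ (begin-strict
  s + a         ≤⟨ +-monoʳ-≤ s a≤s ⟩
  s + s         <⟨ +-monoˡ-< s (m<m+n s 1≤b) ⟩
  (s + b) + s   ≤⟨ +-monoʳ-≤ (s + b) (m≤m+n s c) ⟩
  (s + b) + (s + c) ∎)
  where open ≤-Reasoning

shift-dissociated : ∀ {m} s → m ≤ s → (xs : List ℕ) → All (_≤ m) xs →
  Dissociated xs → Dissociated (map (s +_) xs)
shift-dissociated s _ [] _ _ = tt
shift-dissociated s _ (a ∷ []) _ 1≤a = ≤-trans 1≤a (m≤n+m a s)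
shift-dissociated s _ (a ∷ b ∷ []) _ (1≤a , 1≤b , a≢b) =
  ≤-trans 1≤a (m≤n+m a s) , ≤-trans 1≤b (m≤n+m b s) , a≢b ∘ +-cancelˡ-≡ s _ _
shift-dissociated s m≤s (a ∷ b ∷ c ∷ []) (a≤m ∷ b≤m ∷ c≤m ∷ [])
  (1≤a , 1≤b , 1≤c , a≢b , a≢c , b≢c , _) =
  ≤-trans 1≤a (m≤n+m a s) , ≤-trans 1≤b (m≤n+m b s) , ≤-trans 1≤c (m≤n+m c s) ,
  a≢b ∘ +-cancelˡ-≡ s _ _ , a≢c ∘ +-cancelˡ-≡ s _ _ , b≢c ∘ +-cancelˡ-≡ s _ _ ,
  shift-sum-free (≤-trans a≤m m≤s) 1≤b , shift-sum-free (≤-trans b≤m m≤s) 1≤a ,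
  shift-sum-free (≤-trans c≤m m≤s) 1≤a
shift-dissociated s _ (_ ∷ _ ∷ _ ∷ _ ∷ _) _ ()

extend-dissociated-above : ∀ {y z c} → Dissociated (y ∷ z ∷ []) → y < c → z < c → c ≢ y + z →
  Dissociated (y ∷ z ∷ c ∷ [])
extend-dissociated-above {y} {z} {c} (1≤y , 1≤z , y≢z) y<c z<c c≢y+z =
  1≤y , 1≤z , ≤-trans 1≤y (<⇒≤ y<c) , y≢z , <⇒≢ y<c , <⇒≢ z<c ,
  <⇒≢ (<-≤-trans y<c (m≤n+m c z)) , <⇒≢ (<-≤-trans z<c (m≤n+m c y)) , c≢y+z

shift-extend-dissociated-below : ∀ {m s y z c} → Dissociated (y ∷ z ∷ []) → y ≤ m → z ≤ m →
  m < c → c ≤ s → Dissociated ((s + y) ∷ (s + z) ∷ c ∷ [])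
shift-extend-dissociated-below {m} {s} {y} {z} {c} (1≤y , 1≤z , y≢z) y≤m z≤m m<c c≤s =
  ≤-trans 1≤y (m≤n+m y s) , ≤-trans 1≤z (m≤n+m z s) , ≤-trans (s≤s z≤n) m<c ,
  y≢z ∘ +-cancelˡ-≡ s _ _ , >⇒≢ (c<s+ 1≤y) , >⇒≢ (c<s+ 1≤z) ,
  <⇒≢ (below-sum y≤m z) , <⇒≢ (below-sum z≤m y) ,
  <⇒≢ (<-≤-trans (c<s+ 1≤y) (m≤m+n (s + y) (s + z)))
  where
  c<s+ : ∀ {x} → 1 ≤ x → c < s + x
  c<s+ {x} 1≤x = ≤-<-trans c≤s (m<m+n s 1≤x)
  below-sum : ∀ {x} → x ≤ m → ∀ x′ → s + x < (s + x′) + c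
  below-sum x≤m x′ = <-≤-trans (+-monoʳ-< s (≤-<-trans x≤m m<c)) (+-monoˡ-≤ c (m≤m+n s x′))

≤⇒≢+pos : ∀ {x c y} → x ≤ c → 1 ≤ y → x ≢ c + y
≤⇒≢+pos {c = c} x≤c 1≤y = <⇒≢ (≤-<-trans x≤c (m<m+n c 1≤y))

InBlock : ℕ → ℕ → Set
InBlock width x = 1 ≤ x × x ≤ width

block-position : ∀ {a k} w → a < k → k ≤ a + w → ∃ λ d → InBlock w d × a + d ≡ k
block-position {a} {k} w a<k k≤a+w =
  k ∸ a , (m<n⇒0<n∸m a<k , subst (k ∸ a ≤_) (m+n∸m≡n a w) (∸-monoˡ-≤ a k≤a+w)) , m+[n∸m]≡n (<⇒≤ a<k)

SameEnds : ∀ {A : Set} → A → A → A → A → Set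
SameEnds u v u′ v′ = ((u ≡ u′) × (v ≡ v′)) ⊎ ((u ≡ v′) × (v ≡ u′))

sameEnds-sym : ∀ {A : Set} {u v u′ v′ : A} → SameEnds u v u′ v′ → SameEnds u′ v′ u v
sameEnds-sym (inj₁ (refl , refl)) = inj₁ (refl , refl)
sameEnds-sym (inj₂ (refl , refl)) = inj₂ (refl , refl)

sameEnds-map : ∀ {A B : Set} (f : A → B) {u v u′ v′} →
  SameEnds u v u′ v′ → SameEnds (f u) (f v) (f u′) (f v′)
sameEnds-map f (inj₁ (refl , refl)) = inj₁ (refl , refl)
sameEnds-map f (inj₂ (refl , refl)) = inj₂ (refl , refl)

sameEnds-trans : ∀ {A : Set} {u v u′ v′ u″ v″ : A} →
  SameEnds u v u′ v′ → SameEnds u′ v′ u″ v″ → SameEnds u v u″ v″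
sameEnds-trans (inj₁ (refl , refl)) e = e
sameEnds-trans (inj₂ (refl , refl)) (inj₁ (refl , refl)) = inj₂ (refl , refl)
sameEnds-trans (inj₂ (refl , refl)) (inj₂ (refl , refl)) = inj₁ (refl , refl)

sum-map-+ : ∀ {A : Set} (φ ψ : A → ℕ) ws →
  sum (map (λ w → φ w + ψ w) ws) ≡ sum (map φ ws) + sum (map ψ ws)
sum-map-+ φ ψ [] = refl
sum-map-+ φ ψ (w ∷ ws) = trans (cong (φ w + ψ w +_) (sum-map-+ φ ψ ws))
  (interchange (φ w) (ψ w) (sum (map φ ws)) (sum (map ψ ws)))

sum-map-zero : ∀ {A : Set} (φ : A → ℕ) ws → (∀ {w} → w ∈ ws → φ w ≡ 0) → sum (map φ ws) ≡ 0
sum-map-zero φ [] _ = refl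
sum-map-zero φ (w ∷ ws) φ≡0 rewrite φ≡0 (here refl) = sum-map-zero φ ws (φ≡0 ∘ there)

sum₂-≡ : ∀ {x y x′ y′} → sum (x ∷ y ∷ []) ≡ sum (x′ ∷ y′ ∷ []) → x + y ≡ x′ + y′
sum₂-≡ {x} {y} {x′} {y′} = subst₂ _≡_ (cong (x +_) (+-identityʳ y)) (cong (x′ +_) (+-identityʳ y′))

sum₃-≡ : ∀ {x y z x′ y′ z′} → sum (x ∷ y ∷ z ∷ []) ≡ sum (x′ ∷ y′ ∷ z′ ∷ []) →
  x + (y + z) ≡ x′ + (y′ + z′)
sum₃-≡ {x} {y} {z} {x′} {y′} {z′} =
  subst₂ _≡_ (cong (λ t → x + (y + t)) (+-identityʳ z))
             (cong (λ t → x′ + (y′ + t)) (+-identityʳ z′))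

module SubsetSums {A : Set} (_≟_ : DecidableEquality A) where
  open import Data.List.Membership.DecPropositional _≟_ using (_∈?_)

  select : (A → Bool) → (A → ℕ) → A → ℕ
  select p h w = pick (p w) (h w)

  selectedSum : (A → Bool) → (A → ℕ) → List A → ℕ
  selectedSum p h ws = sum (map (select p h) ws)

  dissociated-selection-injective : ∀ ws (h : A → ℕ) → Dissociated (map h ws) → ∀ p q →
    selectedSum p h ws ≡ selectedSum q h ws → All (λ w → p w ≡ q w) ws
  dissociated-selection-injective [] h _ p q _ = []
  dissociated-selection-injective (a ∷ []) h d p q e =
    pick-injective d (p a) (q a) (+-cancelʳ-≡ 0 _ _ e) ∷ []
  dissociated-selection-injective (a ∷ b ∷ []) h d p q e
    with pick₂-injective d (p a) (p b) (q a) (q b)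
           (sum₂-≡ {select p h a} {select p h b} {select q h a} {select q h b} e)
  ... | pa≡qa , pb≡qb = pa≡qa ∷ pb≡qb ∷ []
  dissociated-selection-injective (a ∷ b ∷ c ∷ []) h d p q e
    with pick₃-injective d (p a) (p b) (p c) (q a) (q b) (q c)
           (sum₃-≡ {select p h a} {select p h b} {select p h c}
                   {select q h a} {select q h b} {select q h c} e)
  ... | pa≡qa , pb≡qb , pc≡qc = pa≡qa ∷ pb≡qb ∷ pc≡qc ∷ []

  sum-select-≟ : ∀ ws (h : A → ℕ) {a} → Unique ws → a ∈ ws →
    selectedSum (λ w → does (w ≟ a)) h ws ≡ h a
  sum-select-≟ (b ∷ ws) h (b≢ws ∷ _) (here refl) rewrite dec-true (b ≟ b) refl =
    trans (cong (h b +_) (sum-map-zero _ ws b-absent)) (+-identityʳ (h b))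
    where
    b-absent : ∀ {w} → w ∈ ws → select (λ w → does (w ≟ b)) h w ≡ 0
    b-absent {w} w∈ws rewrite dec-false (w ≟ b) (All.lookup b≢ws w∈ws ∘ sym) = refl
  sum-select-≟ (b ∷ ws) h (b≢ws ∷ uws) (there a∈ws)
    rewrite dec-false (b ≟ _) (All.lookup b≢ws a∈ws) = sum-select-≟ ws h uws a∈ws

  select-∈-∷ : ∀ {a S} (h : A → ℕ) → All (a ≢_) S → ∀ w →
    select (λ w → does (w ∈? a ∷ S)) h w
      ≡ select (λ w → does (w ≟ a)) h w + select (λ w → does (w ∈? S)) h w
  select-∈-∷ {a} {S} h a≢S w with w ≟ a | w ∈? S
  ... | yes refl | yes a∈S = ⊥-elim (All.lookup a≢S a∈S refl)
  ... | yes refl | no _ = sym (+-identityʳ (h a))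
  ... | no _ | _ = refl

  sum-≡-selectedSum : ∀ {S ws} (h : A → ℕ) → Unique S → Unique ws → All (_∈ ws) S →
    sum (map h S) ≡ selectedSum (λ w → does (w ∈? S)) h ws
  sum-≡-selectedSum {[]} {ws} h _ _ _ = sym (sum-map-zero _ ws (λ _ → refl))
  sum-≡-selectedSum {a ∷ S} {ws} h (a≢S ∷ uS) uws (a∈ws ∷ S⊆ws) = begin
    h a + sum (map h S)
      ≡⟨ cong₂ _+_ (sym (sum-select-≟ ws h uws a∈ws)) (sum-≡-selectedSum h uS uws S⊆ws) ⟩
    selectedSum (λ w → does (w ≟ a)) h ws + selectedSum (λ w → does (w ∈? S)) h ws
      ≡⟨ sum-map-+ _ _ ws ⟨
    sum (map (λ w → select (λ w → does (w ≟ a)) h w + select (λ w → does (w ∈? S)) h w) ws)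
      ≡⟨ cong sum (map-cong (λ w → sym (select-∈-∷ h a≢S w)) ws) ⟩
    selectedSum (λ w → does (w ∈? a ∷ S)) h ws ∎
    where open ≡-Reasoning

  subset-sums-distinct : ∀ ws (h : A → ℕ) (R : A → Set) → Unique ws → Dissociated (map h ws) →
    (∀ {w} → R w → w ∈ ws) → ∀ S T → Unique S → Unique T → All R S → All R T →
    sum (map h S) ≡ sum (map h T) → (∀ w → w ∈ S → w ∈ T) × (∀ w → w ∈ T → w ∈ S)
  subset-sums-distinct ws h R uws d R⊆ws S T uS uT RS RT e =
    (λ w w∈S → member (All.lookup same (All.lookup S⊆ws w∈S)) w∈S) ,
    (λ w w∈T → member (sym (All.lookup same (All.lookup T⊆ws w∈T))) w∈T)
    where
    S⊆ws : All (_∈ ws) S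
    S⊆ws = All.map R⊆ws RS
    T⊆ws : All (_∈ ws) T
    T⊆ws = All.map R⊆ws RT
    same : All (λ w → does (w ∈? S) ≡ does (w ∈? T)) ws
    same = dissociated-selection-injective ws h d _ _
      (trans (sym (sum-≡-selectedSum h uS uws S⊆ws)) (trans e (sum-≡-selectedSum h uT uws T⊆ws)))
    member : ∀ {w} {U V : List A} → does (w ∈? U) ≡ does (w ∈? V) → w ∈ U → w ∈ V
    member {w} {U} {V} eq w∈U with w ∈? V
    ... | yes w∈V = w∈V
    ... | no _ = contradiction (trans (sym (dec-true (w ∈? U) w∈U)) eq) (λ ())

extreme : ∀ n → Fin 3 → SVertex n
extreme n j = replicate n j

data Adj : (n : ℕ) → SVertex n → SVertex n → Set where
  inner  : ∀ {n} i {u v} → Adj n u v → Adj (suc n) (i ∷ u) (i ∷ v)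
  bridge : ∀ {n i j} → i ≢ j → Adj (suc n) (i ∷ extreme n j) (j ∷ extreme n i)

constant⇒extreme : ∀ {n} (u : SVertex n) {j} → (∀ t → lookup u t ≡ j) → u ≡ extreme n j
constant⇒extreme [] _ = refl
constant⇒extreme (x ∷ u) c = cong₂ _∷_ (c 0F) (constant⇒extreme u (c ∘ suc))

SAdj⇒Adj : ∀ n {u v} → SAdj n u v → Adj n u v
SAdj⇒Adj zero (() , _)
SAdj⇒Adj (suc n) {x ∷ u} {y ∷ v} (0F , _ , x≢y , after)
  with constant⇒extreme u (λ t → proj₁ (after (suc t) z<s))
     | constant⇒extreme v (λ t → proj₂ (after (suc t) z<s))
... | refl | refl = bridge x≢y
SAdj⇒Adj (suc n) {x ∷ u} {y ∷ v} (suc h , before , differ , after) with before 0F z<s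
... | refl = inner x (SAdj⇒Adj n (h , (λ t t<h → before (suc t) (s≤s t<h)) , differ ,
                                      (λ t h<t → after (suc t) (s≤s h<t))))

Adj⇒SAdj : ∀ {n u v} → Adj n u v → SAdj n u v
Adj⇒SAdj (inner i a) with Adj⇒SAdj a
... | h , before , differ , after = suc h , before′ , differ , after′
  where
  before′ : ∀ t → toℕ t < toℕ (suc h) → _
  before′ 0F _ = refl
  before′ (suc t) (s≤s t<h) = before t t<h
  after′ : ∀ t → toℕ (suc h) < toℕ t → _
  after′ (suc t) (s≤s h<t) = after t h<t
Adj⇒SAdj (bridge {n} {i} {j} i≢j) = 0F , (λ _ ()) , i≢j , after
  where
  after : ∀ t → 0 < toℕ {suc n} t → _
  after (suc t) _ = lookup-replicate t j , lookup-replicate t i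

edgeCount : ℕ → ℕ
edgeCount zero = 0
edgeCount (suc n) = edgeCount n + 3 + edgeCount n + edgeCount n

offset : ℕ → Fin 3 → ℕ
offset n 0F = 0
offset n 1F = edgeCount n + 3
offset n 2F = edgeCount n + 3 + edgeCount n

bridgeLabel : Fin 3 → Fin 3 → ℕ
bridgeLabel 0F 1F = 2
bridgeLabel 1F 0F = 2
bridgeLabel 0F 2F = 3
bridgeLabel 2F 0F = 3
bridgeLabel 1F 2F = 1
bridgeLabel 2F 1F = 1
bridgeLabel _ _ = 0    -- i ≡ j: not a bridge

label : ∀ n → SVertex n → SVertex n → ℕ
label zero _ _ = 0
label (suc n) (i ∷ u) (j ∷ v) =
  if does (i ≟ᶠ j) then offset n i + label n u v else edgeCount n + bridgeLabel i j

label-inner : ∀ n i u v → label (suc n) (i ∷ u) (i ∷ v) ≡ offset n i + label n u v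
label-inner n i u v rewrite dec-true (i ≟ᶠ i) refl = refl

label-bridge : ∀ n {i j} u v → i ≢ j → label (suc n) (i ∷ u) (j ∷ v) ≡ edgeCount n + bridgeLabel i j
label-bridge n {i} {j} u v i≢j rewrite dec-false (i ≟ᶠ j) i≢j = refl

bridgeLabel-sym : ∀ i j → bridgeLabel i j ≡ bridgeLabel j i
bridgeLabel-sym 0F 0F = refl
bridgeLabel-sym 0F 1F = refl
bridgeLabel-sym 0F 2F = refl
bridgeLabel-sym 1F 0F = refl
bridgeLabel-sym 1F 1F = refl
bridgeLabel-sym 1F 2F = refl
bridgeLabel-sym 2F 0F = refl
bridgeLabel-sym 2F 1F = refl
bridgeLabel-sym 2F 2F = refl

label-sym : ∀ n u v → label n u v ≡ label n v u
label-sym zero _ _ = refl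
label-sym (suc n) (i ∷ u) (j ∷ v) = by-cases (i ≟ᶠ j)
  where
  open ≡-Reasoning
  by-cases : Dec (i ≡ j) → label (suc n) (i ∷ u) (j ∷ v) ≡ label (suc n) (j ∷ v) (i ∷ u)
  by-cases (yes refl) = begin
    label (suc n) (i ∷ u) (i ∷ v)  ≡⟨ label-inner n i u v ⟩
    offset n i + label n u v       ≡⟨ cong (offset n i +_) (label-sym n u v) ⟩
    offset n i + label n v u       ≡⟨ label-inner n i v u ⟨
    label (suc n) (i ∷ v) (i ∷ u)  ∎
  by-cases (no i≢j) = begin
    label (suc n) (i ∷ u) (j ∷ v)   ≡⟨ label-bridge n u v i≢j ⟩
    edgeCount n + bridgeLabel i j   ≡⟨ cong (edgeCount n +_) (bridgeLabel-sym i j) ⟩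
    edgeCount n + bridgeLabel j i   ≡⟨ label-bridge n v u (i≢j ∘ sym) ⟨
    label (suc n) (j ∷ v) (i ∷ u)   ∎

bridgeLabel-bounds : ∀ {i j} → i ≢ j → InBlock 3 (bridgeLabel i j)
bridgeLabel-bounds {0F} {0F} i≢j = ⊥-elim (i≢j refl)
bridgeLabel-bounds {0F} {1F} _ = s≤s z≤n , s≤s (s≤s z≤n)
bridgeLabel-bounds {0F} {2F} _ = s≤s z≤n , ≤-refl
bridgeLabel-bounds {1F} {0F} _ = s≤s z≤n , s≤s (s≤s z≤n)
bridgeLabel-bounds {1F} {1F} i≢j = ⊥-elim (i≢j refl)
bridgeLabel-bounds {1F} {2F} _ = s≤s z≤n , s≤s z≤n
bridgeLabel-bounds {2F} {0F} _ = s≤s z≤n , ≤-refl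
bridgeLabel-bounds {2F} {1F} _ = s≤s z≤n , s≤s z≤n
bridgeLabel-bounds {2F} {2F} i≢j = ⊥-elim (i≢j refl)

offset-block≤edgeCount : ∀ n i → offset n i + edgeCount n ≤ edgeCount (suc n)
offset-block≤edgeCount n 0F =
  ≤-trans (m≤m+n _ 3) (≤-trans (m≤m+n _ (edgeCount n)) (m≤m+n _ (edgeCount n)))
offset-block≤edgeCount n 1F = m≤m+n _ (edgeCount n)
offset-block≤edgeCount n 2F = ≤-refl

offset-gap : ∀ n {i j} → toℕ i < toℕ j → offset n i + edgeCount n ≤ offset n j
offset-gap n {0F} {1F} _ = m≤m+n _ 3
offset-gap n {0F} {2F} _ = ≤-trans (m≤m+n _ 3) (m≤m+n _ (edgeCount n))
offset-gap n {1F} {2F} _ = ≤-refl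
offset-gap n {1F} {1F} (s≤s ())
offset-gap n {2F} {2F} (s≤s (s≤s ()))
offset-gap n {1F} {0F} ()
offset-gap n {2F} {0F} ()
offset-gap n {2F} {1F} (s≤s ())

copies-disjoint : ∀ n {i j x y} → i ≢ j → InBlock (edgeCount n) x → InBlock (edgeCount n) y →
  offset n i + x ≢ offset n j + y
copies-disjoint n {i} {j} {x} {y} i≢j (1≤x , x≤m) (1≤y , y≤m) with <-cmpᶠ i j
... | tri< i<j _ _ = ≤⇒≢+pos (≤-trans (+-monoʳ-≤ (offset n i) x≤m) (offset-gap n i<j)) 1≤y
... | tri≈ _ i≡j _ = ⊥-elim (i≢j i≡j)
... | tri> _ _ j<i = ≤⇒≢+pos (≤-trans (+-monoʳ-≤ (offset n j) y≤m) (offset-gap n j<i)) 1≤x ∘ sym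

copy-≢-bridge : ∀ n i {x b} → InBlock (edgeCount n) x → InBlock 3 b →
  offset n i + x ≢ edgeCount n + b
copy-≢-bridge n 0F (_ , x≤m) (1≤b , _) = ≤⇒≢+pos x≤m 1≤b
copy-≢-bridge n 1F (1≤x , _) (_ , b≤3) = ≤⇒≢+pos (+-monoʳ-≤ (edgeCount n) b≤3) 1≤x ∘ sym
copy-≢-bridge n 2F (1≤x , _) (_ , b≤3) =
  ≤⇒≢+pos (≤-trans (+-monoʳ-≤ (edgeCount n) b≤3) (m≤m+n _ (edgeCount n))) 1≤x ∘ sym

label-bounds : ∀ {n u v} → Adj n u v → InBlock (edgeCount n) (label n u v)
label-bounds {suc n} (inner i {u} {v} a) rewrite label-inner n i u v with label-bounds a
... | 1≤ℓ , ℓ≤m =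
  ≤-trans 1≤ℓ (m≤n+m _ (offset n i)) ,
  ≤-trans (+-monoʳ-≤ (offset n i) ℓ≤m) (offset-block≤edgeCount n i)
label-bounds {suc n} (bridge {i = i} {j} i≢j)
  rewrite label-bridge n (extreme n j) (extreme n i) i≢j =
  ≤-trans (proj₁ (bridgeLabel-bounds i≢j)) (m≤n+m _ (edgeCount n)) ,
  ≤-trans (+-monoʳ-≤ (edgeCount n) (proj₂ (bridgeLabel-bounds i≢j)))
          (≤-trans (m≤m+n _ _) (offset-block≤edgeCount n 1F))

lowerEnd upperEnd : ℕ → Fin 3
lowerEnd 1 = 1F
lowerEnd _ = 0F
upperEnd 2 = 1F
upperEnd _ = 2F

bridgeLabel-ends : ∀ {i j} → i ≢ j →
  SameEnds i j (lowerEnd (bridgeLabel i j)) (upperEnd (bridgeLabel i j))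
bridgeLabel-ends {0F} {0F} i≢j = ⊥-elim (i≢j refl)
bridgeLabel-ends {0F} {1F} _ = inj₁ (refl , refl)
bridgeLabel-ends {0F} {2F} _ = inj₁ (refl , refl)
bridgeLabel-ends {1F} {0F} _ = inj₂ (refl , refl)
bridgeLabel-ends {1F} {1F} i≢j = ⊥-elim (i≢j refl)
bridgeLabel-ends {1F} {2F} _ = inj₁ (refl , refl)
bridgeLabel-ends {2F} {0F} _ = inj₂ (refl , refl)
bridgeLabel-ends {2F} {1F} _ = inj₂ (refl , refl)
bridgeLabel-ends {2F} {2F} i≢j = ⊥-elim (i≢j refl)

bridgeLabel-injective : ∀ {i j i′ j′} → i ≢ j → i′ ≢ j′ → bridgeLabel i j ≡ bridgeLabel i′ j′ →
  SameEnds i j i′ j′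
bridgeLabel-injective {i′ = i′} {j′} i≢j i′≢j′ e = sameEnds-trans (bridgeLabel-ends i≢j)
  (subst (λ b → SameEnds (lowerEnd b) (upperEnd b) i′ j′) (sym e)
    (sameEnds-sym (bridgeLabel-ends i′≢j′)))

label-injective : ∀ {n u v u′ v′} → Adj n u v → Adj n u′ v′ → label n u v ≡ label n u′ v′ →
  SameEnds u v u′ v′
label-injective {suc n} (inner i {u} {v} a) (inner i′ {u′} {v′} a′) e
  with i ≟ᶠ i′ | trans (sym (label-inner n i u v)) (trans e (label-inner n i′ u′ v′))
... | yes refl | e′ = sameEnds-map (i ∷_) (label-injective a a′ (+-cancelˡ-≡ (offset n i) _ _ e′))
... | no i≢i′ | e′ = ⊥-elim (copies-disjoint n i≢i′ (label-bounds a) (label-bounds a′) e′)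
label-injective {suc n} (inner i {u} {v} a) (bridge {i = i′} {j′} i′≢j′) e =
  ⊥-elim (copy-≢-bridge n i (label-bounds a) (bridgeLabel-bounds i′≢j′)
    (trans (sym (label-inner n i u v)) (trans e (label-bridge n _ _ i′≢j′))))
label-injective {suc n} (bridge {i = i} {j} i≢j) (inner i′ {u′} {v′} a′) e =
  ⊥-elim (copy-≢-bridge n i′ (label-bounds a′) (bridgeLabel-bounds i≢j)
    (trans (sym (label-inner n i′ u′ v′)) (trans (sym e) (label-bridge n _ _ i≢j))))
label-injective {suc n} (bridge {i = i} {j} i≢j) (bridge {i = i′} {j′} i′≢j′) e
  with bridgeLabel-injective i≢j i′≢j′
         (+-cancelˡ-≡ (edgeCount n) _ _
           (trans (sym (label-bridge n _ _ i≢j)) (trans e (label-bridge n _ _ i′≢j′))))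
... | inj₁ (refl , refl) = inj₁ (refl , refl)
... | inj₂ (refl , refl) = inj₂ (refl , refl)

Attained : ℕ → ℕ → Set
Attained n k = ∃₂ λ u v → Adj n u v × label n u v ≡ k

attained-in-copy : ∀ n i {k} → (∃ λ d → InBlock (edgeCount n) d × offset n i + d ≡ k) →
  (∀ {d} → InBlock (edgeCount n) d → Attained n d) → Attained (suc n) k
attained-in-copy n i (d , d∈ , refl) attained with attained d∈
... | u , v , a , refl = i ∷ u , i ∷ v , inner i a , label-inner n i u v

attained-on-bridge : ∀ n {k} → (∃ λ b → InBlock 3 b × edgeCount n + b ≡ k) → Attained (suc n) k
attained-on-bridge n (1 , _ , refl) = 1F ∷ extreme n 2F , 2F ∷ extreme n 1F , bridge (λ ()) , refl
attained-on-bridge n (2 , _ , refl) = 0F ∷ extreme n 1F , 1F ∷ extreme n 0F , bridge (λ ()) , refl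
attained-on-bridge n (3 , _ , refl) = 0F ∷ extreme n 2F , 2F ∷ extreme n 0F , bridge (λ ()) , refl
attained-on-bridge n (suc (suc (suc (suc _))) , (_ , s≤s (s≤s (s≤s ()))) , _)

label-surjective : ∀ n {k} → InBlock (edgeCount n) k → Attained n k
label-surjective zero (1≤k , k≤0) with ≤-trans 1≤k k≤0
... | ()
label-surjective (suc n) {k} (1≤k , k≤top) with k ≤? m | k ≤? m + 3 | k ≤? m + 3 + m
  where m = edgeCount n
... | yes k≤m | _ | _ = attained-in-copy n 0F (k , (1≤k , k≤m) , refl) (label-surjective n)
... | no k≰m | yes k≤m+3 | _ = attained-on-bridge n (block-position 3 (≰⇒> k≰m) k≤m+3)
... | no _ | no k≰m+3 | yes k≤2m+3 =
  attained-in-copy n 1F (block-position (edgeCount n) (≰⇒> k≰m+3) k≤2m+3) (label-surjective n)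
... | no _ | no _ | no k≰2m+3 =
  attained-in-copy n 2F (block-position (edgeCount n) (≰⇒> k≰2m+3) k≤top) (label-surjective n)

other₁ other₂ : Fin 3 → Fin 3
other₁ 0F = 1F
other₁ 1F = 0F
other₁ 2F = 0F
other₂ 0F = 2F
other₂ 1F = 2F
other₂ 2F = 1F

other₁≢ : ∀ i → other₁ i ≢ i
other₁≢ 0F ()
other₁≢ 1F ()
other₁≢ 2F ()

other₂≢ : ∀ i → other₂ i ≢ i
other₂≢ 0F ()
other₂≢ 1F ()
other₂≢ 2F ()

other₁≢other₂ : ∀ i → other₁ i ≢ other₂ i
other₁≢other₂ 0F ()
other₁≢other₂ 1F ()
other₁≢other₂ 2F ()

others-cover : ∀ i {j} → j ≢ i → j ≡ other₁ i ⊎ j ≡ other₂ i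
others-cover 0F {0F} j≢i = ⊥-elim (j≢i refl)
others-cover 0F {1F} _ = inj₁ refl
others-cover 0F {2F} _ = inj₂ refl
others-cover 1F {0F} _ = inj₁ refl
others-cover 1F {1F} j≢i = ⊥-elim (j≢i refl)
others-cover 1F {2F} _ = inj₂ refl
others-cover 2F {0F} _ = inj₁ refl
others-cover 2F {1F} _ = inj₂ refl
others-cover 2F {2F} j≢i = ⊥-elim (j≢i refl)

_≟ᵛ_ : ∀ {n} → DecidableEquality (SVertex n)
_≟ᵛ_ = ≡-decᵛ _≟ᶠ_

bridgeTo : ∀ n → Fin 3 → SVertex n → Fin 3 → List (SVertex (suc n))
bridgeTo n i v j = if does (v ≟ᵛ extreme n j) then (j ∷ extreme n i) ∷ [] else []

bridgeNeighbours : ∀ n → Fin 3 → SVertex n → List (SVertex (suc n))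
bridgeNeighbours n i v = bridgeTo n i v (other₁ i) ++ bridgeTo n i v (other₂ i)

neighbours : ∀ n → SVertex n → List (SVertex n)
neighbours zero [] = []
neighbours (suc n) (i ∷ v) = map (i ∷_) (neighbours n v) ++ bridgeNeighbours n i v

bridgeTo-extreme : ∀ n i j → bridgeTo n i (extreme n j) j ≡ (j ∷ extreme n i) ∷ []
bridgeTo-extreme n i j rewrite dec-true (extreme n j ≟ᵛ extreme n j) refl = refl

bridgeTo-other : ∀ n i {v j} → v ≢ extreme n j → bridgeTo n i v j ≡ []
bridgeTo-other n i {v} {j} v≢ rewrite dec-false (v ≟ᵛ extreme n j) v≢ = refl

∈-bridgeTo : ∀ {n i v j w} → w ∈ bridgeTo n i v j → w ≡ j ∷ extreme n i × v ≡ extreme n j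
∈-bridgeTo {n} {i} {v} {j} = by-cases (v ≟ᵛ extreme n j)
  where
  by-cases : ∀ {w} (d : Dec (v ≡ extreme n j)) →
    w ∈ (if does d then (j ∷ extreme n i) ∷ [] else []) → w ≡ j ∷ extreme n i × v ≡ extreme n j
  by-cases (yes v≡) (here refl) = refl , v≡

∈-bridgeNeighbours : ∀ {n i v w} → w ∈ bridgeNeighbours n i v →
  ∃ λ j → j ≢ i × w ≡ j ∷ extreme n i × v ≡ extreme n j
∈-bridgeNeighbours {n} {i} {v} w∈ with ∈-++⁻ (bridgeTo n i v (other₁ i)) w∈
... | inj₁ w∈₁ = other₁ i , other₁≢ i , ∈-bridgeTo w∈₁
... | inj₂ w∈₂ = other₂ i , other₂≢ i , ∈-bridgeTo w∈₂

neighbours-sound : ∀ n {v w} → w ∈ neighbours n v → Adj n v w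
neighbours-sound (suc n) {i ∷ v} w∈ with ∈-++⁻ (map (i ∷_) (neighbours n v)) w∈
... | inj₁ w∈copy with ∈-map⁻ (i ∷_) w∈copy
...   | w′ , w′∈ , refl = inner i (neighbours-sound n w′∈)
neighbours-sound (suc n) {i ∷ v} _ | inj₂ w∈bridges with ∈-bridgeNeighbours {n} {i} {v} w∈bridges
...   | j , j≢i , refl , refl = bridge (j≢i ∘ sym)

neighbours-complete : ∀ {n v w} → Adj n v w → w ∈ neighbours n v
neighbours-complete (inner i a) = ∈-++⁺ˡ (∈-map⁺ (i ∷_) (neighbours-complete a))
neighbours-complete (bridge {n} {i} {j} i≢j) =
  ∈-++⁺ʳ (map (i ∷_) (neighbours n (extreme n j))) (in-bridges (others-cover i (i≢j ∘ sym)))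
  where
  here-in : ∀ k → k ≡ j → (j ∷ extreme n i) ∈ bridgeTo n i (extreme n j) k
  here-in _ refl rewrite bridgeTo-extreme n i j = here refl
  in-bridges : j ≡ other₁ i ⊎ j ≡ other₂ i → (j ∷ extreme n i) ∈ bridgeNeighbours n i (extreme n j)
  in-bridges (inj₁ j≡) = ∈-++⁺ˡ (here-in (other₁ i) (sym j≡))
  in-bridges (inj₂ j≡) =
    ∈-++⁺ʳ (bridgeTo n i (extreme n j) (other₁ i)) (here-in (other₂ i) (sym j≡))

bridgeTo-unique : ∀ n i v j → Unique (bridgeTo n i v j)
bridgeTo-unique n i v j with does (v ≟ᵛ extreme n j)
... | true = [] ∷ []
... | false = []

bridgeNeighbours-unique : ∀ n i v → Unique (bridgeNeighbours n i v)
bridgeNeighbours-unique n i v =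
  Unique.++⁺ (bridgeTo-unique n i v (other₁ i)) (bridgeTo-unique n i v (other₂ i)) disjoint
  where
  disjoint : ∀ {w} → ¬ (w ∈ bridgeTo n i v (other₁ i) × w ∈ bridgeTo n i v (other₂ i))
  disjoint (w∈₁ , w∈₂) with ∈-bridgeTo {n} {i} {v} w∈₁ | ∈-bridgeTo {n} {i} {v} w∈₂
  ... | refl , _ | w≡ , _ = other₁≢other₂ i (∷-injectiveˡ w≡)

neighbours-unique : ∀ n v → Unique (neighbours n v)
neighbours-unique zero [] = []
neighbours-unique (suc n) (i ∷ v) =
  Unique.++⁺ (Unique.map⁺ ∷-injectiveʳ (neighbours-unique n v)) (bridgeNeighbours-unique n i v)
    disjoint
  where
  disjoint : ∀ {w} → ¬ (w ∈ map (i ∷_) (neighbours n v) × w ∈ bridgeNeighbours n i v)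
  disjoint (w∈copy , w∈bridges)
    with ∈-map⁻ (i ∷_) w∈copy | ∈-bridgeNeighbours {n} {i} {v} w∈bridges
  ... | _ , _ , refl | j , j≢i , w≡ , _ = j≢i (∷-injectiveˡ (sym w≡))

bridgeNeighbours-nonextreme : ∀ n i {v} → (∀ j → v ≢ extreme n j) → bridgeNeighbours n i v ≡ []
bridgeNeighbours-nonextreme n i v≢
  rewrite bridgeTo-other n i (v≢ (other₁ i)) | bridgeTo-other n i (v≢ (other₂ i)) = refl

bridgeTo-distinct-extreme : ∀ n i {j k} → j ≢ k → bridgeTo (suc n) i (extreme (suc n) j) k ≡ []
bridgeTo-distinct-extreme n i {j} j≢k = bridgeTo-other (suc n) i {extreme (suc n) j} (j≢k ∘ ∷-injectiveˡ)

bridgeNeighbours-self : ∀ n i → bridgeNeighbours (suc n) i (extreme (suc n) i) ≡ []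
bridgeNeighbours-self n i
  rewrite bridgeTo-distinct-extreme n i (other₁≢ i ∘ sym)
        | bridgeTo-distinct-extreme n i (other₂≢ i ∘ sym) = refl

bridgeNeighbours-extreme : ∀ n {i j} → j ≢ i →
  bridgeNeighbours (suc n) i (extreme (suc n) j) ≡ (j ∷ extreme (suc n) i) ∷ []
bridgeNeighbours-extreme n {i} j≢i with others-cover i j≢i
... | inj₁ refl
  rewrite bridgeTo-extreme (suc n) i (other₁ i)
        | bridgeTo-distinct-extreme n i (other₁≢other₂ i) = refl
... | inj₂ refl
  rewrite bridgeTo-distinct-extreme n i (other₁≢other₂ i ∘ sym)
        | bridgeTo-extreme (suc n) i (other₂ i) = refl

labelsAt : ∀ n → SVertex n → List ℕ
labelsAt n v = map (label n v) (neighbours n v)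

dissociated⇒isARVertex : ∀ n v → Dissociated (labelsAt n v) → IsARVertex n (label n) v
dissociated⇒isARVertex n v d =
  SubsetSums.subset-sums-distinct _≟ᵛ_ (neighbours n v) (label n v) (SAdj n v)
    (neighbours-unique n v) d (λ a → neighbours-complete (SAdj⇒Adj n a))

labelsAt-bounded : ∀ n v → All (_≤ edgeCount n) (labelsAt n v)
labelsAt-bounded n v = map⁺ (All.tabulate (λ w∈ → proj₂ (label-bounds (neighbours-sound n w∈))))

labelsAt-∷ : ∀ n i v → labelsAt (suc n) (i ∷ v)
  ≡ map (offset n i +_) (labelsAt n v) ++ map (label (suc n) (i ∷ v)) (bridgeNeighbours n i v)
labelsAt-∷ n i v = begin
  map ℓ (map (i ∷_) (neighbours n v) ++ B)        ≡⟨ map-++ ℓ (map (i ∷_) (neighbours n v)) B ⟩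
  map ℓ (map (i ∷_) (neighbours n v)) ++ map ℓ B  ≡⟨ cong (_++ map ℓ B) copy-labels ⟩
  map (offset n i +_) (labelsAt n v) ++ map ℓ B   ∎
  where
  open ≡-Reasoning
  ℓ : SVertex (suc n) → ℕ
  ℓ = label (suc n) (i ∷ v)
  B : List (SVertex (suc n))
  B = bridgeNeighbours n i v
  copy-labels : map ℓ (map (i ∷_) (neighbours n v)) ≡ map (offset n i +_) (labelsAt n v)
  copy-labels = trans (sym (map-∘ (neighbours n v)))
    (trans (map-cong (λ w → label-inner n i v w) (neighbours n v)) (map-∘ (neighbours n v)))

-- The extreme vertex j…j of S(n,3) reappears in copy 0F of S(n+1,3), where for j ≢ 0F it
-- gains the bridge label edgeCount n + bridgeLabel 0F j; the sum of its two inherited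
-- labels must avoid that value.  The lower bounds make the condition hereditary.
ExtremeSum : ℕ → Fin 3 → ℕ → Set
ExtremeSum n 0F t = ⊤
ExtremeSum n 1F t = edgeCount n ≤ t × t ≢ edgeCount n + 2
ExtremeSum n 2F t = 1 ≤ t × t ≢ edgeCount n + 3

extremeSum-step : ∀ n j {y z} → ExtremeSum n j (y + z) →
  ExtremeSum (suc n) j ((offset n j + y) + (offset n j + z))
extremeSum-step n 0F _ = tt
extremeSum-step n 1F {y} {z} (m≤t , _) =
  ≤-trans (m≤m+n _ 3) bound ,
  λ e → <⇒≢ (<-≤-trans (+-monoʳ-< (edgeCount (suc n)) (n<1+n 2)) bound) (sym e)
  where
  m s : ℕ
  m = edgeCount n
  s = m + 3
  bound : edgeCount (suc n) + 3 ≤ (s + y) + (s + z)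
  bound = begin
    edgeCount (suc n) + 3  ≡⟨ identity m ⟩
    (s + s) + m            ≤⟨ +-monoʳ-≤ (s + s) m≤t ⟩
    (s + s) + (y + z)      ≡⟨ interchange s y s z ⟨
    (s + y) + (s + z)      ∎
    where
    open ≤-Reasoning
    identity : ∀ m → m + 3 + m + m + 3 ≡ (m + 3) + (m + 3) + m
    identity = solve-∀
extremeSum-step n 2F {y} {z} (1≤t , _) = ≤-trans (s≤s z≤n) bound , λ e → <⇒≢ bound (sym e)
  where
  m s : ℕ
  m = edgeCount n
  s = m + 3 + m
  bound : edgeCount (suc n) + 3 < (s + y) + (s + z)
  bound = begin-strict
    edgeCount (suc n) + 3       ≤⟨ m≤m+n _ m ⟩
    edgeCount (suc n) + 3 + m   ≡⟨ identity m ⟩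
    s + s                       <⟨ m<m+n (s + s) 1≤t ⟩
    (s + s) + (y + z)           ≡⟨ interchange s y s z ⟨
    (s + y) + (s + z)           ∎
    where
    open ≤-Reasoning
    identity : ∀ m → m + 3 + m + m + 3 + m ≡ (m + 3 + m) + (m + 3 + m)
    identity = solve-∀

ExtremeLabels : ℕ → Fin 3 → Set
ExtremeLabels n j = ∃₂ λ y z → labelsAt n (extreme n j) ≡ y ∷ z ∷ [] × ExtremeSum n j (y + z)

extreme-labels : ∀ n j → ExtremeLabels (suc n) j
extreme-labels zero 0F = 2 , 3 , refl , tt
extreme-labels zero 1F = 2 , 1 , refl , ≤-refl , (λ ())
extreme-labels zero 2F = 3 , 1 , refl , s≤s z≤n , (λ ())
extreme-labels (suc n) j with extreme-labels n j
... | y , z , labels≡ , sum-ok =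
  offset (suc n) j + y , offset (suc n) j + z , labels≡′ , extremeSum-step (suc n) j sum-ok
  where
  labels≡′ : labelsAt (suc (suc n)) (extreme (suc (suc n)) j)
    ≡ (offset (suc n) j + y) ∷ (offset (suc n) j + z) ∷ []
  labels≡′ rewrite labelsAt-∷ (suc n) j (extreme (suc n) j) | labels≡ | bridgeNeighbours-self n j =
    refl

copy-dissociated : ∀ n i v → Dissociated (labelsAt n v) →
  Dissociated (map (offset n i +_) (labelsAt n v))
copy-dissociated n 0F v d = subst Dissociated (sym (map-id (labelsAt n v))) d
copy-dissociated n 1F v d =
  shift-dissociated (offset n 1F) (m≤m+n _ 3) (labelsAt n v) (labelsAt-bounded n v) d
copy-dissociated n 2F v d =
  shift-dissociated (offset n 2F) (≤-trans (m≤m+n _ 3) (m≤m+n _ _))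
    (labelsAt n v) (labelsAt-bounded n v) d

bridged-extreme-dissociated : ∀ n i j {y z} → j ≢ i → ExtremeSum n j (y + z) →
  Dissociated (y ∷ z ∷ []) → y ≤ edgeCount n → z ≤ edgeCount n →
  Dissociated ((offset n i + y) ∷ (offset n i + z) ∷ (edgeCount n + bridgeLabel i j) ∷ [])
bridged-extreme-dissociated n 0F 0F j≢i _ _ _ _ = ⊥-elim (j≢i refl)
bridged-extreme-dissociated n 0F 1F _ (_ , t≢) d y≤m z≤m =
  extend-dissociated-above d (≤-<-trans y≤m (m<m+n _ z<s)) (≤-<-trans z≤m (m<m+n _ z<s)) (t≢ ∘ sym)
bridged-extreme-dissociated n 0F 2F _ (_ , t≢) d y≤m z≤m =
  extend-dissociated-above d (≤-<-trans y≤m (m<m+n _ z<s)) (≤-<-trans z≤m (m<m+n _ z<s)) (t≢ ∘ sym)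
bridged-extreme-dissociated n 1F j j≢i _ d y≤m z≤m with bridgeLabel-bounds (j≢i ∘ sym)
... | 1≤b , b≤3 =
  shift-extend-dissociated-below d y≤m z≤m (m<m+n _ 1≤b) (+-monoʳ-≤ (edgeCount n) b≤3)
bridged-extreme-dissociated n 2F j j≢i _ d y≤m z≤m with bridgeLabel-bounds (j≢i ∘ sym)
... | 1≤b , b≤3 =
  shift-extend-dissociated-below d y≤m z≤m (m<m+n _ 1≤b)
    (≤-trans (+-monoʳ-≤ (edgeCount n) b≤3) (m≤m+n _ _))

unbridged-dissociated : ∀ n i v → bridgeNeighbours n i v ≡ [] → Dissociated (labelsAt n v) →
  Dissociated (labelsAt (suc n) (i ∷ v))
unbridged-dissociated n i v none d
  rewrite labelsAt-∷ n i v | none | ++-identityʳ (map (offset n i +_) (labelsAt n v)) =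
  copy-dissociated n i v d

bridged-dissociated : ∀ n {i j} → j ≢ i → Dissociated (labelsAt (suc n) (extreme (suc n) j)) →
  Dissociated (labelsAt (suc (suc n)) (i ∷ extreme (suc n) j))
bridged-dissociated n {i} {j} j≢i d with extreme-labels n j
... | y , z , labels≡ , sum-ok
  with subst (All (_≤ edgeCount (suc n))) labels≡ (labelsAt-bounded (suc n) (extreme (suc n) j))
     | subst Dissociated labels≡ d
...   | y≤m ∷ z≤m ∷ [] | yz-dissociated
  rewrite labelsAt-∷ (suc n) i (extreme (suc n) j) | labels≡ | bridgeNeighbours-extreme n j≢i
        | label-bridge (suc n) (extreme (suc n) j) (extreme (suc n) i) (j≢i ∘ sym) =
  bridged-extreme-dissociated (suc n) i j j≢i sum-ok yz-dissociated y≤m z≤m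

vertex-in-copy-dissociated : ∀ n i v → Dissociated (labelsAt (suc n) v) →
  Dissociated (labelsAt (suc (suc n)) (i ∷ v))
vertex-in-copy-dissociated n i v d with any? (λ j → v ≟ᵛ extreme (suc n) j)
... | no v-nonextreme =
  unbridged-dissociated (suc n) i v
    (bridgeNeighbours-nonextreme (suc n) i (λ j e → v-nonextreme (j , e))) d
... | yes (j , refl) with j ≟ᶠ i
...   | yes refl = unbridged-dissociated (suc n) i v (bridgeNeighbours-self n i) d
...   | no j≢i = bridged-dissociated n j≢i d

labelsAt-dissociated : ∀ n v → Dissociated (labelsAt n v)
labelsAt-dissociated zero [] = tt
labelsAt-dissociated 1 (0F ∷ []) = s≤s z≤n , s≤s z≤n , (λ ())
labelsAt-dissociated 1 (1F ∷ []) = s≤s z≤n , s≤s z≤n , (λ ())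
labelsAt-dissociated 1 (2F ∷ []) = s≤s z≤n , s≤s z≤n , (λ ())
labelsAt-dissociated (suc (suc n)) (i ∷ v) =
  vertex-in-copy-dissociated n i v (labelsAt-dissociated (suc n) v)

theorem3 : ∀ (n : ℕ) → 1 ≤ n → SierpinskiIsARGraph n
theorem3 n _ =
  edgeCount n , label n , label-sym n ,
  (λ u v u′ v′ a a′ → label-injective (SAdj⇒Adj n a) (SAdj⇒Adj n a′)) ,
  (λ u v a → label-bounds (SAdj⇒Adj n a)) ,
  (λ k 1≤k k≤m → attained⇒SAdj (label-surjective n (1≤k , k≤m))) ,
  (λ v → dissociated⇒isARVertex n v (labelsAt-dissociated n v))
  where
  attained⇒SAdj : ∀ {k} → Attained n k → ∃₂ λ u v → SAdj n u v × label n u v ≡ k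
  attained⇒SAdj (u , v , a , e) = u , v , Adj⇒SAdj a , e
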